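{- Let $n\ge 0$ and $0\le k\le n$. The number of pairs $(T,M)$, where $T$ is a binary tree on $n+1$ vertices and $M$ is a set of exactly $k$ vertices of $T$ containing no vertex of the right spine of $T$, equals $B_{n,k}$.
   Context: A binary tree is a rooted plane tree in which each vertex has at most two children, each designated as a left or right child. The right spine of $T$ consists of the root and every vertex $u$ such that each vertex on the path from the root to $u$ (other than the root) is the right child of its parent. Catalan's triangle: $C_{n,s}=\frac{n-s+1}{n+1}\binom{n+s}{n}$; Borel's triangle: $B_{n,k}=\sum_{s=k}^{n}\binom{s}{k}C_{n,s}$. -}

module Defs where

open import Data.Nat using (ℕ; zero; suc; _+_; _*_; _∸_)
open import Data.Nat.DivMod using (_/_)
open import Data.Nat.Combinatorics using (_C_)
open import Data.List using (List; map; upTo)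
open import Data.Nat.ListAction using (sum)
open import Data.Bool using (Bool; true; false)
open import Data.Unit using (⊤)
open import Data.Product using (_×_)
open import Relation.Binary.PropositionalEquality using (_≡_)

data BinTree : Set where
  empty : BinTree
  node  : BinTree → BinTree → BinTree

size : BinTree → ℕ
size empty      = 0
size (node l r) = suc (size l + size r)

-- A subset M of the vertices of T, given as a Bool label on every vertex
-- (true = the vertex belongs to M).
data Marking : BinTree → Set where
  empty : Marking empty
  node  : ∀ {l r} → Bool → Marking l → Marking r → Marking (node l r)

card : ∀ {T} → Marking T → ℕ
card empty            = 0
card (node true  ml mr) = suc (card ml + card mr)
card (node false ml mr) = card ml + card mr

AvoidsRightSpine : ∀ {T} → Marking T → Set
AvoidsRightSpine empty          = ⊤
AvoidsRightSpine (node b ml mr) = (b ≡ false) × AvoidsRightSpine mr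

-- Catalan's triangle  C_{n,s} = (n-s+1)/(n+1) * binom(n+s, n)  (an integer)
catalanTri : ℕ → ℕ → ℕ
catalanTri n s = ((suc (n ∸ s)) * ((n + s) C n)) / suc n

borelTri : ℕ → ℕ → ℕ
borelTri n k = sum (map (λ i → ((k + i) C k) * catalanTri n (k + i)) (upTo (suc (n ∸ k))))

module Submission where

open import Defs
open import Data.Nat using (ℕ; zero; suc; _+_; _*_; _∸_; _≤_; _<_; _≟_; z≤n; s≤s)
open import Data.Nat.Properties
open import Data.Nat.DivMod using (_/_; m*n/n≡m)
open import Data.Nat.Combinatorics using (_C_; nCk≡nC[n∸k]; nCn≡1; nC1≡n; k>n⇒nCk≡0; nCk+nC[k+1]≡[n+1]C[k+1])
open import Data.Nat.Tactic.RingSolver using (solve-∀)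
open import Data.Nat.ListAction using (sum)
open import Data.List using (List; []; _∷_; length; map; applyUpTo)
open import Data.Fin using (Fin; zero; suc; toℕ; fromℕ<)
open import Data.Fin.Properties using (toℕ-fromℕ<; toℕ-injective; toℕ<n; +↔⊎; 0↔⊥; 1↔⊤)
open import Data.Bool using (false; true)
open import Data.Unit using (⊤; tt)
open import Data.Empty using (⊥; ⊥-elim)
open import Data.Sum using (_⊎_; inj₁; inj₂)
open import Data.Sum.Function.Propositional using (_⊎-↔_)
open import Data.Product using (Σ; Σ-syntax; _×_; _,_; proj₁; proj₂)
open import Data.Product.Function.NonDependent.Propositional using (_×-↔_)
open import Data.Product.Function.Dependent.Propositional using (Σ-↔)
open import Function.Bundles using (_↔_; mk↔ₛ′)
open import Function.Properties.Inverse using (↔-sym; ↔-trans)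
open import Function.Related.Propositional using (module EquationalReasoning)
open import Relation.Nullary.Decidable using (recompute)
open import Relation.Binary.PropositionalEquality
open import Algebra.Properties.CommutativeSemigroup +-commutativeSemigroup using (x∙yz≈y∙xz)

-- Cutting a tree along its right spine, which carries no marks, leaves the
-- sequence of left subtrees hanging off the spine: r marked binary trees with
-- s vertices in total, where r + s = n + 1.  Sequences of r binary trees with
-- s vertices are counted by ballot numbers; by the reflection principle
-- ballot r (t + 1) = C(N, t + 1) - C(N, t) for N = r + 2t + 1, which gives
-- (n + 1) ballot (n + 1 - s) s = (n - s + 1) C(n + s, s), i.e. C_{n,s}.
-- The k marks are placed independently on the s vertices in C(s, k) ways,
-- and summing over s yields B_{n,k}.

-- Pascal's recursion; _C_ itself is defined through factorials.
choose : ℕ → ℕ → ℕ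
choose n       zero    = 1
choose zero    (suc k) = 0
choose (suc n) (suc k) = choose n k + choose n (suc k)

choose≡C : ∀ n k → choose n k ≡ n C k
choose≡C n       zero    = sym (trans (nCk≡nC[n∸k] {0} {n} z≤n) (nCn≡1 n))
choose≡C zero    (suc k) = sym (k>n⇒nCk≡0 {0} {suc k} (s≤s z≤n))
choose≡C (suc n) (suc k) =
  trans (cong₂ _+_ (choose≡C n k) (choose≡C n (suc k))) (nCk+nC[k+1]≡[n+1]C[k+1] n k)

choose-< : ∀ {n k} → n < k → choose n k ≡ 0
choose-< {zero}  {suc k} _         = refl
choose-< {suc n} {suc k} (s≤s n<k) = cong₂ _+_ (choose-< n<k) (choose-< (m<n⇒m<1+n n<k))

choose-sym : ∀ a b → choose (a + b) a ≡ choose (a + b) b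
choose-sym a b = begin
  choose (a + b) a        ≡⟨ choose≡C (a + b) a ⟩
  (a + b) C a             ≡⟨ nCk≡nC[n∸k] (m≤m+n a b) ⟩
  (a + b) C (a + b ∸ a)   ≡⟨ cong ((a + b) C_) (m+n∸m≡n a b) ⟩
  (a + b) C b             ≡⟨ choose≡C (a + b) b ⟨
  choose (a + b) b        ∎
  where open ≡-Reasoning

absorption : ∀ n k → suc k * choose (suc n) (suc k) ≡ suc n * choose n k
absorption zero    zero    = refl
absorption zero    (suc k) = *-zeroʳ (suc (suc k))
absorption (suc n) zero    = begin
  1 * (1 + choose (suc n) 1)  ≡⟨ cong (λ m → 1 * (1 + m)) (trans (choose≡C (suc n) 1) (nC1≡n (suc n))) ⟩
  1 * (2 + n)                 ≡⟨ *-comm 1 (2 + n) ⟩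
  (2 + n) * 1                 ∎
  where open ≡-Reasoning
absorption (suc n) (suc k) = begin
  suc (suc k) * (c₁ + c₂)                            ≡⟨ expand (suc k) c₁ c₂ ⟩
  (suc k * c₁ + c₁) + suc (suc k) * c₂               ≡⟨ cong₂ (λ x y → (x + c₁) + y) (absorption n k) (absorption n (suc k)) ⟩
  (suc n * choose n k + c₁) + suc n * choose n (suc k) ≡⟨ collect (suc n) (choose n k) (choose n (suc k)) c₁ ⟩
  suc n * c₁ + c₁                                    ≡⟨ +-comm (suc n * c₁) c₁ ⟩
  suc (suc n) * c₁                                   ∎
  where
  open ≡-Reasoning
  c₁ = choose (suc n) (suc k)
  c₂ = choose (suc n) (suc (suc k))
  expand : ∀ a x y → suc a * (x + y) ≡ (a * x + x) + suc a * y
  expand = solve-∀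
  collect : ∀ a x y z → (a * x + z) + a * y ≡ a * (x + y) + z
  collect = solve-∀

-- The number of sequences of r binary trees with s vertices in total: either
-- the first tree is empty, or it is replaced by its two subtrees.
ballot : ℕ → ℕ → ℕ
ballot zero    zero    = 1
ballot zero    (suc s) = 0
ballot (suc r) zero    = ballot r zero
ballot (suc r) (suc s) = ballot r (suc s) + ballot (suc (suc r)) s

ballot-zero : ∀ r → ballot r 0 ≡ 1
ballot-zero zero    = refl
ballot-zero (suc r) = ballot-zero r

ballot-reflection : ∀ r t N → N ≡ r + t + suc t → ballot r (suc t) + choose N t ≡ choose N (suc t)
ballot-reflection zero    t       N       refl = choose-sym t (suc t)
ballot-reflection (suc r) t       zero    ()
ballot-reflection (suc r) zero    (suc N) eq = begin
  (ballot r 1 + ballot (suc (suc r)) 0) + 1  ≡⟨ cong (λ x → (ballot r 1 + x) + 1) (ballot-zero (suc (suc r))) ⟩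
  (ballot r 1 + 1) + 1                       ≡⟨ cong (_+ 1) (ballot-reflection r zero N (suc-injective eq)) ⟩
  choose N 1 + 1                             ≡⟨ +-comm (choose N 1) 1 ⟩
  choose (suc N) 1                           ∎
  where open ≡-Reasoning
ballot-reflection (suc r) (suc t) (suc N) eq = begin
  (ballot r (2 + t) + ballot (2 + r) (suc t)) + (choose N t + choose N (suc t))
    ≡⟨ interchange (ballot r (2 + t)) (ballot (2 + r) (suc t)) (choose N t) (choose N (suc t)) ⟩
  (ballot (2 + r) (suc t) + choose N t) + (ballot r (2 + t) + choose N (suc t))
    ≡⟨ cong₂ _+_ (ballot-reflection (2 + r) t N (trans (suc-injective eq) (shift r t)))
                 (ballot-reflection r (suc t) N (suc-injective eq)) ⟩
  choose N (suc t) + choose N (2 + t)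
    ∎
  where
  open ≡-Reasoning
  interchange : ∀ a b c d → (a + b) + (c + d) ≡ (b + c) + (a + d)
  interchange = solve-∀
  shift : ∀ r t → r + suc t + (2 + t) ≡ 2 + r + t + suc t
  shift = solve-∀

ballot-closed-form : ∀ d s → suc (d + s) * ballot (suc d) s ≡ suc d * choose (d + s + s) s
ballot-closed-form d zero    = cong₂ (λ m b → suc m * b) (+-identityʳ d) (ballot-zero (suc d))
ballot-closed-form d (suc t) = +-cancelʳ-≡ (c * c₁) (a * b) (suc d * c₁) (begin
  a * b + c * c₁    ≡⟨ cong (a * b +_) ratio ⟩
  a * b + a * c₀    ≡⟨ *-distribˡ-+ a b c₀ ⟨
  a * (b + c₀)      ≡⟨ cong (a *_) (ballot-reflection (suc d) t N (shift d t)) ⟩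
  a * c₁            ≡⟨ split d t c₁ ⟩
  suc d * c₁ + c * c₁ ∎)
  where
  open ≡-Reasoning
  N  = d + suc t + suc t
  a  = suc (d + suc t)
  c  = suc t
  b  = ballot (suc d) (suc t)
  c₀ = choose N t
  c₁ = choose N (suc t)
  shift : ∀ d t → d + suc t + suc t ≡ suc d + t + suc t
  shift = solve-∀
  split : ∀ d t x → suc (d + suc t) * x ≡ suc d * x + suc t * x
  split = solve-∀
  ratio : c * c₁ ≡ a * c₀
  ratio = +-cancelʳ-≡ (c * c₀) (c * c₁) (a * c₀) (begin
    c * c₁ + c * c₀   ≡⟨ +-comm (c * c₁) (c * c₀) ⟩
    c * c₀ + c * c₁   ≡⟨ *-distribˡ-+ c c₀ c₁ ⟨
    c * (c₀ + c₁)     ≡⟨ absorption N t ⟩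
    (a + c) * c₀      ≡⟨ *-distribʳ-+ c₀ a c ⟩
    a * c₀ + c * c₀   ∎)

catalanTri[d+s]≡ballot : ∀ d s → catalanTri (d + s) s ≡ ballot (suc d) s
catalanTri[d+s]≡ballot d s = begin
  (suc (d + s ∸ s) * ((d + s + s) C (d + s))) / suc (d + s)
    ≡⟨ cong (λ m → (suc m * ((d + s + s) C (d + s))) / suc (d + s)) (m+n∸n≡m d s) ⟩
  (suc d * ((d + s + s) C (d + s))) / suc (d + s)
    ≡⟨ cong (λ m → (suc d * m) / suc (d + s)) (trans (sym (choose≡C (d + s + s) (d + s))) (choose-sym (d + s) s)) ⟩
  (suc d * choose (d + s + s) s) / suc (d + s)
    ≡⟨ cong (_/ suc (d + s)) (trans (sym (ballot-closed-form d s)) (*-comm (suc (d + s)) _)) ⟩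
  (ballot (suc d) s * suc (d + s)) / suc (d + s)
    ≡⟨ m*n/n≡m (ballot (suc d) s) (suc (d + s)) ⟩
  ballot (suc d) s
    ∎
  where open ≡-Reasoning

catalanTri≡ballot : ∀ {n s} → s ≤ n → catalanTri n s ≡ ballot (suc n ∸ s) s
catalanTri≡ballot {n} {s} s≤n = begin
  catalanTri n s                   ≡⟨ cong (λ m → catalanTri m s) (m∸n+n≡m s≤n) ⟨
  catalanTri (n ∸ s + s) s         ≡⟨ catalanTri[d+s]≡ballot (n ∸ s) s ⟩
  ballot (suc (n ∸ s)) s           ≡⟨ cong (λ r → ballot r s) (+-∸-assoc 1 s≤n) ⟨
  ballot (suc n ∸ s) s             ∎
  where open ≡-Reasoning

MarkedTree : Set
MarkedTree = Σ BinTree Marking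

vertices : List MarkedTree → ℕ
vertices []             = 0
vertices ((T , _) ∷ ts) = size T + vertices ts

marks : List MarkedTree → ℕ
marks []             = 0
marks ((_ , M) ∷ ts) = card M + marks ts

-- The constraints are irrelevant, so two forests are equal as soon as their
-- lists of trees are.
record MarkedForest (r s k : ℕ) : Set where
  constructor forest
  field
    trees     : List MarkedTree
    .length≡  : length trees ≡ r
    .vertices≡ : vertices trees ≡ s
    .marks≡   : marks trees ≡ k

emptyHead : ∀ {r s k} → MarkedForest r s k → MarkedForest (suc r) s k
emptyHead (forest ts len vs ms) = forest ((empty , empty) ∷ ts) (cong suc len) vs ms

unmarkedHead : ∀ {r s k} → MarkedForest (2 + r) s k → MarkedForest (suc r) (suc s) k
unmarkedHead (forest ((l , ml) ∷ (r , mr) ∷ ts) len vs ms) =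
  forest ((node l r , node false ml mr) ∷ ts) (suc-injective len)
         (cong suc (trans (+-assoc (size l) _ _) vs)) (trans (+-assoc (card ml) _ _) ms)

markedHead : ∀ {r s k} → MarkedForest (2 + r) s k → MarkedForest (suc r) (suc s) (suc k)
markedHead (forest ((l , ml) ∷ (r , mr) ∷ ts) len vs ms) =
  forest ((node l r , node true ml mr) ∷ ts) (suc-injective len)
         (cong suc (trans (+-assoc (size l) _ _) vs)) (cong suc (trans (+-assoc (card ml) _ _) ms))

forest-0-0-0↔⊤ : MarkedForest 0 0 0 ↔ ⊤
forest-0-0-0↔⊤ = mk↔ₛ′ (λ _ → tt) (λ _ → forest [] refl refl refl) (λ _ → refl) λ where
  (forest [] _ _ _) → refl

forest↔⊥ : ∀ {r s k} → (MarkedForest r s k → ⊥) → MarkedForest r s k ↔ ⊥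
forest↔⊥ ¬f = mk↔ₛ′ ¬f (λ ()) (λ ()) (λ f → ⊥-elim (¬f f))

forest-suc-0↔ : ∀ {r k} → MarkedForest (suc r) 0 k ↔ MarkedForest r 0 k
forest-suc-0↔ = mk↔ₛ′ to emptyHead (λ _ → refl) λ where
    (forest ((empty , empty) ∷ ts) _ _ _) → refl
  where
  to : ∀ {r k} → MarkedForest (suc r) 0 k → MarkedForest r 0 k
  to (forest ((empty , empty) ∷ ts) len vs ms) = forest ts (suc-injective len) vs ms

forest-suc-suc-0↔ : ∀ {r s} →
  MarkedForest (suc r) (suc s) 0 ↔ (MarkedForest r (suc s) 0 ⊎ MarkedForest (2 + r) s 0)
forest-suc-suc-0↔ = mk↔ₛ′ to from to∘from from∘to
  where
  to : ∀ {r s} → MarkedForest (suc r) (suc s) 0 → MarkedForest r (suc s) 0 ⊎ MarkedForest (2 + r) s 0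
  to (forest ((empty , empty) ∷ ts) len vs ms) = inj₁ (forest ts (suc-injective len) vs ms)
  to (forest ((node l r , node false ml mr) ∷ ts) len vs ms) =
    inj₂ (forest ((l , ml) ∷ (r , mr) ∷ ts) (cong suc len)
                 (trans (sym (+-assoc (size l) _ _)) (suc-injective vs)) (trans (sym (+-assoc (card ml) _ _)) ms))
  from : ∀ {r s} → MarkedForest r (suc s) 0 ⊎ MarkedForest (2 + r) s 0 → MarkedForest (suc r) (suc s) 0
  from (inj₁ f) = emptyHead f
  from (inj₂ f) = unmarkedHead f
  to∘from : ∀ {r s} (f : MarkedForest r (suc s) 0 ⊎ MarkedForest (2 + r) s 0) → to (from f) ≡ f
  to∘from (inj₁ f) = refl
  to∘from (inj₂ (forest (_ ∷ _ ∷ _) _ _ _)) = refl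
  from∘to : ∀ {r s} (f : MarkedForest (suc r) (suc s) 0) → from (to f) ≡ f
  from∘to (forest ((empty , empty) ∷ _) _ _ _) = refl
  from∘to (forest ((node _ _ , node false _ _) ∷ _) _ _ _) = refl

forest-suc-suc-suc↔ : ∀ {r s k} → MarkedForest (suc r) (suc s) (suc k) ↔
  (MarkedForest r (suc s) (suc k) ⊎ (MarkedForest (2 + r) s (suc k) ⊎ MarkedForest (2 + r) s k))
forest-suc-suc-suc↔ = mk↔ₛ′ to from to∘from from∘to
  where
  Pieces : ℕ → ℕ → ℕ → Set
  Pieces r s k = MarkedForest r (suc s) (suc k) ⊎ (MarkedForest (2 + r) s (suc k) ⊎ MarkedForest (2 + r) s k)
  to : ∀ {r s k} → MarkedForest (suc r) (suc s) (suc k) → Pieces r s k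
  to (forest ((empty , empty) ∷ ts) len vs ms) = inj₁ (forest ts (suc-injective len) vs ms)
  to (forest ((node l r , node false ml mr) ∷ ts) len vs ms) =
    inj₂ (inj₁ (forest ((l , ml) ∷ (r , mr) ∷ ts) (cong suc len)
                       (trans (sym (+-assoc (size l) _ _)) (suc-injective vs)) (trans (sym (+-assoc (card ml) _ _)) ms)))
  to (forest ((node l r , node true ml mr) ∷ ts) len vs ms) =
    inj₂ (inj₂ (forest ((l , ml) ∷ (r , mr) ∷ ts) (cong suc len)
                       (trans (sym (+-assoc (size l) _ _)) (suc-injective vs))
                       (trans (sym (+-assoc (card ml) _ _)) (suc-injective ms))))
  from : ∀ {r s k} → Pieces r s k → MarkedForest (suc r) (suc s) (suc k)
  from (inj₁ f)        = emptyHead f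
  from (inj₂ (inj₁ f)) = unmarkedHead f
  from (inj₂ (inj₂ f)) = markedHead f
  to∘from : ∀ {r s k} (f : Pieces r s k) → to (from f) ≡ f
  to∘from (inj₁ f) = refl
  to∘from (inj₂ (inj₁ (forest (_ ∷ _ ∷ _) _ _ _))) = refl
  to∘from (inj₂ (inj₂ (forest (_ ∷ _ ∷ _) _ _ _))) = refl
  from∘to : ∀ {r s k} (f : MarkedForest (suc r) (suc s) (suc k)) → from (to f) ≡ f
  from∘to (forest ((empty , empty) ∷ _) _ _ _) = refl
  from∘to (forest ((node _ _ , node false _ _) ∷ _) _ _ _) = refl
  from∘to (forest ((node _ _ , node true _ _) ∷ _) _ _ _) = refl

forestCount : ℕ → ℕ → ℕ → ℕ
forestCount zero    zero    zero    = 1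
forestCount zero    zero    (suc k) = 0
forestCount zero    (suc s) k       = 0
forestCount (suc r) zero    k       = forestCount r zero k
forestCount (suc r) (suc s) zero    = forestCount r (suc s) zero + forestCount (2 + r) s zero
forestCount (suc r) (suc s) (suc k) =
  forestCount r (suc s) (suc k) + (forestCount (2 + r) s (suc k) + forestCount (2 + r) s k)

forestCount≡ballot*choose : ∀ r s k → forestCount r s k ≡ ballot r s * choose s k
forestCount≡ballot*choose zero    zero    zero    = refl
forestCount≡ballot*choose zero    zero    (suc k) = refl
forestCount≡ballot*choose zero    (suc s) k       = refl
forestCount≡ballot*choose (suc r) zero    k       = forestCount≡ballot*choose r zero k
forestCount≡ballot*choose (suc r) (suc s) zero    = begin
  forestCount r (suc s) 0 + forestCount (2 + r) s 0
    ≡⟨ cong₂ _+_ (forestCount≡ballot*choose r (suc s) 0) (forestCount≡ballot*choose (2 + r) s 0) ⟩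
  ballot r (suc s) * 1 + ballot (2 + r) s * 1
    ≡⟨ *-distribʳ-+ 1 (ballot r (suc s)) _ ⟨
  ballot (suc r) (suc s) * 1
    ∎
  where open ≡-Reasoning
forestCount≡ballot*choose (suc r) (suc s) (suc k) = begin
  forestCount r (suc s) (suc k) + (forestCount (2 + r) s (suc k) + forestCount (2 + r) s k)
    ≡⟨ cong₂ _+_ (forestCount≡ballot*choose r (suc s) (suc k))
                 (cong₂ _+_ (forestCount≡ballot*choose (2 + r) s (suc k)) (forestCount≡ballot*choose (2 + r) s k)) ⟩
  x * (c + c′) + (y * c′ + y * c)
    ≡⟨ regroup x y c c′ ⟩
  (x + y) * (c + c′)
    ∎
  where
  open ≡-Reasoning
  x  = ballot r (suc s)
  y  = ballot (2 + r) s
  c  = choose s k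
  c′ = choose s (suc k)
  regroup : ∀ x y c c′ → x * (c + c′) + (y * c′ + y * c) ≡ (x + y) * (c + c′)
  regroup = solve-∀

forest↔Fin : ∀ r s k → MarkedForest r s k ↔ Fin (forestCount r s k)
forest↔Fin zero    zero    zero    = ↔-trans forest-0-0-0↔⊤ (↔-sym 1↔⊤)
forest↔Fin zero    zero    (suc k) = ↔-trans (forest↔⊥ λ { (forest [] _ _ ()) ; (forest (_ ∷ _) () _ _) }) (↔-sym 0↔⊥)
forest↔Fin zero    (suc s) k       = ↔-trans (forest↔⊥ λ { (forest [] _ () _) ; (forest (_ ∷ _) () _ _) }) (↔-sym 0↔⊥)
forest↔Fin (suc r) zero    k       = ↔-trans forest-suc-0↔ (forest↔Fin r zero k)
forest↔Fin (suc r) (suc s) zero    =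
  ↔-trans forest-suc-suc-0↔ (↔-trans (forest↔Fin r (suc s) 0 ⊎-↔ forest↔Fin (2 + r) s 0) (↔-sym +↔⊎))
forest↔Fin (suc r) (suc s) (suc k) =
  ↔-trans forest-suc-suc-suc↔
    (↔-trans (forest↔Fin r (suc s) (suc k)
              ⊎-↔ ↔-trans (forest↔Fin (2 + r) s (suc k) ⊎-↔ forest↔Fin (2 + r) s k) (↔-sym +↔⊎))
             (↔-sym +↔⊎))

sumBelow : ℕ → (ℕ → ℕ) → ℕ
sumBelow zero    f = 0
sumBelow (suc m) f = f 0 + sumBelow m (λ i → f (suc i))

Σ-Fin↔sumBelow : ∀ {P : ℕ → Set} N (f : ℕ → ℕ) → (∀ i → P i ↔ Fin (f i)) →
  (Σ[ i ∈ Fin N ] P (toℕ i)) ↔ Fin (sumBelow N f)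
Σ-Fin↔sumBelow zero    f P↔ = ↔-trans (mk↔ₛ′ (λ ()) (λ ()) (λ ()) (λ ())) (↔-sym 0↔⊥)
Σ-Fin↔sumBelow {P} (suc N) f P↔ =
  ↔-trans split
    (↔-trans (P↔ 0 ⊎-↔ Σ-Fin↔sumBelow N (λ i → f (suc i)) (λ i → P↔ (suc i))) (↔-sym +↔⊎))
  where
  split : (Σ[ i ∈ Fin (suc N) ] P (toℕ i)) ↔ (P 0 ⊎ Σ[ i ∈ Fin N ] P (suc (toℕ i)))
  split = mk↔ₛ′
    (λ { (zero , p) → inj₁ p ; (suc i , p) → inj₂ (i , p) })
    (λ { (inj₁ p) → zero , p ; (inj₂ (i , p)) → suc i , p })
    (λ { (inj₁ p) → refl ; (inj₂ (i , p)) → refl })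
    (λ { (zero , p) → refl ; (suc i , p) → refl })

sum-map-applyUpTo : ∀ m (g h : ℕ → ℕ) → sum (map h (applyUpTo g m)) ≡ sumBelow m (λ i → h (g i))
sum-map-applyUpTo zero    g h = refl
sum-map-applyUpTo (suc m) g h = cong (h (g 0) +_) (sum-map-applyUpTo m (λ i → g (suc i)) h)

sumBelow-+ : ∀ a b f → sumBelow (a + b) f ≡ sumBelow a f + sumBelow b (λ i → f (a + i))
sumBelow-+ zero    b f = refl
sumBelow-+ (suc a) b f =
  trans (cong (f 0 +_) (sumBelow-+ a b (λ i → f (suc i)))) (sym (+-assoc (f 0) _ _))

sumBelow-cong : ∀ m {f g} → (∀ {i} → i < m → f i ≡ g i) → sumBelow m f ≡ sumBelow m g
sumBelow-cong zero    f≡g = refl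
sumBelow-cong (suc m) f≡g = cong₂ _+_ (f≡g (s≤s z≤n)) (sumBelow-cong m (λ i<m → f≡g (s≤s i<m)))

sumBelow-zero : ∀ m {f} → (∀ {i} → i < m → f i ≡ 0) → sumBelow m f ≡ 0
sumBelow-zero zero    f≡0 = refl
sumBelow-zero (suc m) f≡0 = cong₂ _+_ (f≡0 (s≤s z≤n)) (sumBelow-zero m (λ i<m → f≡0 (s≤s i<m)))

sumBelow-forestCount≡borelTri : ∀ {n k} → k ≤ n →
  sumBelow (suc n) (λ s → forestCount (suc n ∸ s) s k) ≡ borelTri n k
sumBelow-forestCount≡borelTri {n} {k} k≤n = begin
  sumBelow (suc n) f
    ≡⟨ cong (λ m → sumBelow m f) (trans (+-suc k (n ∸ k)) (cong suc (m+[n∸m]≡n k≤n))) ⟨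
  sumBelow (k + suc (n ∸ k)) f
    ≡⟨ sumBelow-+ k (suc (n ∸ k)) f ⟩
  sumBelow k f + sumBelow (suc (n ∸ k)) (λ i → f (k + i))
    ≡⟨ cong₂ _+_ (sumBelow-zero k below-k) (sumBelow-cong (suc (n ∸ k)) from-k) ⟩
  sumBelow (suc (n ∸ k)) g
    ≡⟨ sum-map-applyUpTo (suc (n ∸ k)) (λ i → i) g ⟨
  borelTri n k
    ∎
  where
  open ≡-Reasoning
  f : ℕ → ℕ
  f s = forestCount (suc n ∸ s) s k
  g : ℕ → ℕ
  g i = ((k + i) C k) * catalanTri n (k + i)
  f≡ : ∀ s → f s ≡ ballot (suc n ∸ s) s * choose s k
  f≡ s = forestCount≡ballot*choose (suc n ∸ s) s k
  below-k : ∀ {s} → s < k → f s ≡ 0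
  below-k {s} s<k = trans (f≡ s) (trans (cong (ballot (suc n ∸ s) s *_) (choose-< s<k)) (*-zeroʳ (ballot (suc n ∸ s) s)))
  from-k : ∀ {i} → i < suc (n ∸ k) → f (k + i) ≡ g i
  from-k {i} i≤n∸k = begin
    f (k + i)                                            ≡⟨ f≡ (k + i) ⟩
    ballot (suc n ∸ (k + i)) (k + i) * choose (k + i) k  ≡⟨ cong₂ _*_ (sym (catalanTri≡ballot k+i≤n)) (choose≡C (k + i) k) ⟩
    catalanTri n (k + i) * ((k + i) C k)                 ≡⟨ *-comm (catalanTri n (k + i)) _ ⟩
    g i                                                  ∎
    where
    k+i≤n : k + i ≤ n
    k+i≤n = subst (k + i ≤_) (m+[n∸m]≡n k≤n) (+-monoʳ-≤ k (≤-pred i≤n∸k))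

SpineAvoiding : Set
SpineAvoiding = Σ[ T ∈ BinTree ] Σ[ M ∈ Marking T ] AvoidsRightSpine M

leftSubtrees : SpineAvoiding → List MarkedTree
leftSubtrees (empty    , empty         , _)        = []
leftSubtrees (node l r , node _ ml mr , (_ , av)) = (l , ml) ∷ leftSubtrees (r , mr , av)

graftOnSpine : MarkedTree → SpineAvoiding → SpineAvoiding
graftOnSpine (l , ml) (r , mr , av) = node l r , node false ml mr , refl , av

spineTree : List MarkedTree → SpineAvoiding
spineTree []       = empty , empty , tt
spineTree (t ∷ ts) = graftOnSpine t (spineTree ts)

leftSubtrees-spineTree : ∀ ts → leftSubtrees (spineTree ts) ≡ ts
leftSubtrees-spineTree []       = refl
leftSubtrees-spineTree (t ∷ ts) = cong (t ∷_) (leftSubtrees-spineTree ts)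

spineTree-leftSubtrees : ∀ A → spineTree (leftSubtrees A) ≡ A
spineTree-leftSubtrees (empty    , empty            , tt)        = refl
spineTree-leftSubtrees (node l r , node .false ml mr , (refl , av)) =
  cong (graftOnSpine (l , ml)) (spineTree-leftSubtrees (r , mr , av))

spineAvoiding↔List : SpineAvoiding ↔ List MarkedTree
spineAvoiding↔List = mk↔ₛ′ leftSubtrees spineTree leftSubtrees-spineTree spineTree-leftSubtrees

size-leftSubtrees : ∀ A → let ts = leftSubtrees A in size (proj₁ A) ≡ length ts + vertices ts
size-leftSubtrees (empty    , empty         , _)        = refl
size-leftSubtrees (node l r , node _ ml mr , (_ , av)) = cong suc (begin
  size l + size r                 ≡⟨ cong (size l +_) (size-leftSubtrees (r , mr , av)) ⟩
  size l + (length ts + vertices ts) ≡⟨ x∙yz≈y∙xz (size l) (length ts) (vertices ts) ⟩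
  length ts + (size l + vertices ts) ∎)
  where
  open ≡-Reasoning
  ts = leftSubtrees (r , mr , av)

card-leftSubtrees : ∀ A → card (proj₁ (proj₂ A)) ≡ marks (leftSubtrees A)
card-leftSubtrees (empty    , empty            , _)          = refl
card-leftSubtrees (node l r , node .false ml mr , (refl , av)) = cong (card ml +_) (card-leftSubtrees (r , mr , av))

≡-substˡ-↔ : ∀ {a b c : ℕ} → a ≡ b → (a ≡ c) ↔ (b ≡ c)
≡-substˡ-↔ a≡b = mk↔ₛ′ (trans (sym a≡b)) (trans a≡b) (λ _ → ≡-irrelevant _ _) (λ _ → ≡-irrelevant _ _)

vertices< : ∀ {n} ts → length ts + vertices ts ≡ suc n → vertices ts < suc n
vertices< (t ∷ ts) eq = s≤s (subst (vertices (t ∷ ts) ≤_) (suc-injective eq) (m≤n+m _ (length ts)))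

SpineList : ℕ → ℕ → Set
SpineList n k = Σ[ ts ∈ List MarkedTree ] (length ts + vertices ts ≡ suc n × marks ts ≡ k)

spineList↔Σforest : ∀ n k → SpineList n k ↔ (Σ[ s ∈ Fin (suc n) ] MarkedForest (suc n ∸ toℕ s) (toℕ s) k)
spineList↔Σforest n k = mk↔ₛ′ to from to∘from from∘to
  where
  open ≡-Reasoning
  to : SpineList n k → Σ[ s ∈ Fin (suc n) ] MarkedForest (suc n ∸ toℕ s) (toℕ s) k
  to (ts , len+vs , ms) = fromℕ< lt , forest ts length≡ (sym (toℕ-fromℕ< lt)) ms
    where
    lt = vertices< ts len+vs
    length≡ : length ts ≡ suc n ∸ toℕ (fromℕ< lt)
    length≡ = begin
      length ts                           ≡⟨ m+n∸n≡m (length ts) (vertices ts) ⟨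
      length ts + vertices ts ∸ vertices ts ≡⟨ cong₂ _∸_ len+vs (sym (toℕ-fromℕ< lt)) ⟩
      suc n ∸ toℕ (fromℕ< lt)              ∎
  from : Σ[ s ∈ Fin (suc n) ] MarkedForest (suc n ∸ toℕ s) (toℕ s) k → SpineList n k
  from (s , forest ts len vs ms) =
    ts , recompute (_ ≟ _) (trans (cong₂ _+_ len vs) (m∸n+n≡m (<⇒≤ (toℕ<n s)))) , recompute (_ ≟ _) ms
  Σ-forest-≡ : ∀ {s s′ ts} → s ≡ s′ → ∀ .{len vs ms len′ vs′ ms′} →
    _≡_ {A = Σ[ s ∈ Fin (suc n) ] MarkedForest (suc n ∸ toℕ s) (toℕ s) k}
        (s , forest ts len vs ms) (s′ , forest ts len′ vs′ ms′)
  Σ-forest-≡ refl = refl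
  to∘from : ∀ x → to (from x) ≡ x
  to∘from (s , forest ts len vs ms) = Σ-forest-≡ (toℕ-injective (trans (toℕ-fromℕ< _) (recompute (_ ≟ _) vs)))
  from∘to : ∀ x → from (to x) ≡ x
  from∘to (ts , _ , _) = cong (ts ,_) (cong₂ _,_ (≡-irrelevant _ _) (≡-irrelevant _ _))

theorem8 : (n k : ℕ) → k ≤ n →
    (Σ[ T ∈ BinTree ] (size T ≡ suc n) × (Σ[ M ∈ Marking T ] (card M ≡ k) × AvoidsRightSpine M))
      ↔ Fin (borelTri n k)
theorem8 n k k≤n = begin
  (Σ[ T ∈ BinTree ] (size T ≡ suc n) × (Σ[ M ∈ Marking T ] (card M ≡ k) × AvoidsRightSpine M))
    ↔⟨ reassociate ⟩
  (Σ[ A ∈ SpineAvoiding ] (size (proj₁ A) ≡ suc n × card (proj₁ (proj₂ A)) ≡ k))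
    ↔⟨ Σ-↔ spineAvoiding↔List (λ {A} →
           ≡-substˡ-↔ (size-leftSubtrees A) ×-↔ ≡-substˡ-↔ (card-leftSubtrees A)) ⟩
  SpineList n k
    ↔⟨ spineList↔Σforest n k ⟩
  (Σ[ s ∈ Fin (suc n) ] MarkedForest (suc n ∸ toℕ s) (toℕ s) k)
    ↔⟨ Σ-Fin↔sumBelow (suc n) _ (λ s → forest↔Fin (suc n ∸ s) s k) ⟩
  Fin (sumBelow (suc n) (λ s → forestCount (suc n ∸ s) s k))
    ≡⟨ cong Fin (sumBelow-forestCount≡borelTri k≤n) ⟩
  Fin (borelTri n k)
    ∎
  where
  open EquationalReasoning
  reassociate : (Σ[ T ∈ BinTree ] (size T ≡ suc n) × (Σ[ M ∈ Marking T ] (card M ≡ k) × AvoidsRightSpine M))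
              ↔ (Σ[ A ∈ SpineAvoiding ] (size (proj₁ A) ≡ suc n × card (proj₁ (proj₂ A)) ≡ k))
  reassociate = mk↔ₛ′ (λ (T , e , M , c , av) → (T , M , av) , e , c)
                      (λ ((T , M , av) , e , c) → T , e , M , c , av)
                      (λ _ → refl) (λ _ → refl)
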